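{- Let $w\in S_n$, $D\in RP(w)$ and $1\le i<n$, and let $r=\phi(D)$. Under the correspondence sending a cross $(k,j)\in D_+$ to the letter $k+j-1$ of block $r^k$, the pairing process on row $i$ of $D$ corresponds to the pairing process on block $r^i$ of $r$. Precisely: a cross $c$ in row $i$ is paired with a cross $c_+$ in row $i+1$ (pairing process on row $i$ of $D$) if and only if the letter corresponding to $c$ is paired with the letter corresponding to $c_+$ (pairing process on block $r^i$ of $r$). Consequently a cross in row $i$ or row $i+1$ is unpaired if and only if its corresponding letter is unpaired.
   Context: Index the boxes of the $n\times n$ grid by $(i,j)$, row $i$ from the top, column $j$ from the left. Pipe dreams. A pipe dream is a covering of each box by a cross tile or an elbow tile, where crosses are only allowed in boxes with $i+j\le n$. Connecting tiles gives pipes that enter at the left of each row and exit at the top of a column: a cross lets one pipe pass horizontally and one vertically; an elbow joins the left edge to the top edge and the bottom edge to the right edge. $D$ is a pipe dream for $w$ if the pipe entering row $i$ exits from column $w(i)$. It is reduced if any two pipes cross at most once. $RP(w)$ is the set of reduced pipe dreams for $w$, and $D_+$ is the set of boxes carrying crosses. Pairing on pipe dreams (row $i$). The crosses of row $i$ are considered from right to left. The cross $(i,j)$ is paired with the leftmost not-yet-paired cross of row $i+1$ in a column $\ge j$, if one exists; otherwise it is unpaired. Crosses of row $i+1$ never paired are unpaired. Reduced factorizations with cutoff. For $v\in S_n$, $RFC(v)$ is the set of reduced words $a_1\cdots a_p$ of $v$ (meaning $v=s_{a_1}\cdots s_{a_p}$, $p=\ell(v)$) divided into $n-1$ consecutive,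 possibly empty, blocks $r=(r^{n-1})\cdots(r^1)$, numbered right to left, such that letters strictly increase within each block and the leftmost letter of each nonempty $r^i$ is $\ge i$. Pairing on factorizations (block $i$). The letters of $r^i$ are considered from largest to smallest. A letter $a$ is paired with the smallest not-yet-paired letter $b$ of $r^{i+1}$ with $a<b$, if one exists; otherwise $a$ is unpaired. Letters of $r^{i+1}$ never paired are unpaired. The map $\phi:RP(w)\to RFC(w^{ -1})$ sends $D$ to the factorization whose block $r^k$ consists of the numbers $k+j-1$ for crosses $(k,j)\in D_+$ in row $k$, in increasing order. It is a bijection. -}

module Defs where

open import Data.Nat using (ℕ; zero; suc; _+_; _∸_; _≤_; _≤ᵇ_; _<ᵇ_)
open import Data.Bool using (Bool; true; false)
open import Data.Unit using (⊤)
open import Data.Empty using (⊥)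
open import Data.Fin using (Fin; toℕ)
open import Data.Fin.Permutation using (Permutation′; _⟨$⟩ʳ_)
open import Data.List using (List; []; _∷_; filterᵇ; reverse; map; applyUpTo)
open import Data.Maybe using (Maybe; just; nothing)
open import Data.Product using (_×_; _,_; ∃)
open import Data.Sum using (_⊎_)
open import Relation.Binary.PropositionalEquality using (_≡_; _≢_)

-- Conventions: 1-indexed coordinates (i , j) = (row from top, column from left).
-- A (candidate) pipe dream on the n×n grid is a Bool-valued function on boxes:
-- D i j ≡ true  means box (i,j) carries a cross tile, false means an elbow tile.
PipeDream : Set
PipeDream = ℕ → ℕ → Bool

CrossesAllowed : ℕ → PipeDream → Set
CrossesAllowed n D = ∀ i j → D i j ≡ true → (1 ≤ i) × (1 ≤ j) × (i + j ≤ n)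

data Side : Set where
  fromLeft fromBottom : Side

ExitsTop : Bool → Side → Set
ExitsTop true  fromBottom = ⊤
ExitsTop false fromLeft   = ⊤
ExitsTop _     _          = ⊥

ExitsRight : Bool → Side → Set
ExitsRight true  fromLeft   = ⊤
ExitsRight false fromBottom = ⊤
ExitsRight _     _          = ⊥

-- Visits n D p i j s : the pipe entering the grid at the left of row p
-- enters box (i,j) from side s.
data Visits (n : ℕ) (D : PipeDream) (p : ℕ) : ℕ → ℕ → Side → Set where
  start   : 1 ≤ p → p ≤ n → Visits n D p p 1 fromLeft
  goRight : ∀ {i j s} → Visits n D p i j s → ExitsRight (D i j) s → suc j ≤ n →
            Visits n D p i (suc j) fromLeft
  goUp    : ∀ {i j s} → Visits n D p (suc (suc i)) j s → ExitsTop (D (suc (suc i)) j) s →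
            Visits n D p (suc i) j fromBottom

ExitsAt : ℕ → PipeDream → ℕ → ℕ → Set
ExitsAt n D p c = ∃ λ s → Visits n D p 1 c s × ExitsTop (D 1 c) s

IsPipeDreamFor : (n : ℕ) → Permutation′ n → PipeDream → Set
IsPipeDreamFor n w D =
  CrossesAllowed n D ×
  (∀ (i : Fin n) → ExitsAt n D (suc (toℕ i)) (suc (toℕ (w ⟨$⟩ʳ i))))

CrossAt : ℕ → PipeDream → ℕ → ℕ → ℕ → ℕ → Set
CrossAt n D p q i j =
  D i j ≡ true ×
  ((Visits n D p i j fromLeft × Visits n D q i j fromBottom) ⊎
   (Visits n D p i j fromBottom × Visits n D q i j fromLeft))

IsReduced : ℕ → PipeDream → Set
IsReduced n D = ∀ p q → p ≢ q → ∀ i j i' j' →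
  CrossAt n D p q i j → CrossAt n D p q i' j' → (i ≡ i') × (j ≡ j')

InRP : (n : ℕ) → Permutation′ n → PipeDream → Set
InRP n w D = IsPipeDreamFor n w D × IsReduced n D

crossCols : ℕ → PipeDream → ℕ → List ℕ
crossCols n D i = filterᵇ (D i) (applyUpTo suc n)

pickCol : ℕ → List ℕ → Maybe (ℕ × List ℕ)
pickCol j [] = nothing
pickCol j (x ∷ xs) with j ≤ᵇ x
... | true  = just (x , xs)
... | false with pickCol j xs
...   | nothing        = nothing
...   | just (y , ys)  = just (y , x ∷ ys)

-- first list: columns of row i (processed in the given order, right to left);
-- second list: not-yet-paired columns of row i+1 (increasing).
-- result: pairs (j , j') meaning cross (i,j) is paired with cross (i+1,j').
pairCols : List ℕ → List ℕ → List (ℕ × ℕ)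
pairCols [] avail = []
pairCols (j ∷ js) avail with pickCol j avail
... | nothing          = pairCols js avail
... | just (j' , rest) = (j , j') ∷ pairCols js rest

rowPairs : ℕ → PipeDream → ℕ → List (ℕ × ℕ)
rowPairs n D i = pairCols (reverse (crossCols n D i)) (crossCols n D (suc i))

-- Factorizations: r k is the block r^k (letters in increasing order).
Factorization : Set
Factorization = ℕ → List ℕ

φ : ℕ → PipeDream → Factorization
φ n D k = map (λ j → k + j ∸ 1) (crossCols n D k)

pickLetter : ℕ → List ℕ → Maybe (ℕ × List ℕ)
pickLetter a [] = nothing
pickLetter a (x ∷ xs) with a <ᵇ x
... | true  = just (x , xs)
... | false with pickLetter a xs
...   | nothing        = nothing
...   | just (y , ys)  = just (y , x ∷ ys)

pairLetters : List ℕ → List ℕ → List (ℕ × ℕ)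
pairLetters [] avail = []
pairLetters (a ∷ as) avail with pickLetter a avail
... | nothing         = pairLetters as avail
... | just (b , rest) = (a , b) ∷ pairLetters as rest

blockPairs : Factorization → ℕ → List (ℕ × ℕ)
blockPairs r i = pairLetters (reverse (r i)) (r (suc i))

-- φ relabels the crosses of row i by j ↦ i + j - 1 and those of row i+1 by
-- j' ↦ i + j', and i + j - 1 < i + j' holds exactly when j ≤ j'. So at every step
-- the letter picker on block r^i makes the same choice as the column picker on
-- row i, and the block pairing is the image of the row pairing under an
-- injective relabelling of both components.
{-# OPTIONS --safe #-}
module Submission where

open import Defs
open import Level using (Level)
open import Data.Nat using (ℕ; suc; zero; _+_; _∸_; _≤_; _<_; _≤ᵇ_; _<ᵇ_; s≤s; z≤n)
open import Data.Nat.Properties using (+-cancelˡ-≡; suc-injective)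
open import Data.Bool using (true; false)
open import Data.Fin.Permutation using (Permutation′)
open import Data.Product as Product using (_×_; _,_; ∃)
open import Data.Maybe as Maybe using (just; nothing)
open import Data.List using (List; []; _∷_; map; reverse)
open import Data.List.Properties using (reverse-map)
open import Data.List.Membership.Propositional using (_∈_)
open import Data.List.Membership.Propositional.Properties using (∈-map⁺; ∈-map⁻)
open import Relation.Binary.PropositionalEquality using (_≡_; refl; cong; sym)
open import Relation.Nullary using (¬_)
open import Function using (_∘_)
open import Function.Bundles using (_⇔_; mk⇔)
open import Function.Definitions using (Injective)
open import Function.Related.TypeIsomorphisms using (¬-cong-⇔)

private
  variable
    a b c d : Level
    A : Set a
    B : Set b
    C : Set c
    D′ : Set d

k+m<ᵇ1+k+n≡m≤ᵇn : ∀ k m n → (k + m <ᵇ suc (k + n)) ≡ (m ≤ᵇ n)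
k+m<ᵇ1+k+n≡m≤ᵇn zero    zero    n = refl
k+m<ᵇ1+k+n≡m≤ᵇn zero    (suc m) n = refl
k+m<ᵇ1+k+n≡m≤ᵇn (suc k) m       n = k+m<ᵇ1+k+n≡m≤ᵇn k m n

module OrderCompatibleRelabelling
  (f g : ℕ → ℕ) (compatible : ∀ m n → (f m <ᵇ g n) ≡ (m ≤ᵇ n)) where

  pickLetter-map : ∀ m xs →
    pickLetter (f m) (map g xs) ≡ Maybe.map (Product.map g (map g)) (pickCol m xs)
  pickLetter-map m []       = refl
  pickLetter-map m (x ∷ xs) rewrite compatible m x with m ≤ᵇ x
  ... | true = refl
  ... | false rewrite pickLetter-map m xs with pickCol m xs
  ...   | nothing       = refl
  ...   | just (y , ys) = refl

  pairLetters-map : ∀ xs ys →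
    pairLetters (map f xs) (map g ys) ≡ map (Product.map f g) (pairCols xs ys)
  pairLetters-map []       ys = refl
  pairLetters-map (x ∷ xs) ys rewrite pickLetter-map x ys with pickCol x ys
  ... | nothing         = pairLetters-map xs ys
  ... | just (y , rest) = cong (_ ∷_) (pairLetters-map xs rest)

blockPairs-φ : ∀ n D k → blockPairs (φ n D) (suc k) ≡
  map (Product.map (k +_) (suc ∘ (k +_))) (rowPairs n D (suc k))
blockPairs-φ n D k rewrite sym (reverse-map (k +_) (crossCols n D (suc k))) =
  pairLetters-map (reverse (crossCols n D (suc k))) (crossCols n D (suc (suc k)))
  where open OrderCompatibleRelabelling (k +_) (suc ∘ (k +_)) (k+m<ᵇ1+k+n≡m≤ᵇn k)

module _ {f : A → C} {g : B → D′} where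

  map-×-∈⇔ : Injective _≡_ _≡_ f → Injective _≡_ _≡_ g → ∀ ps {x y} →
    ((x , y) ∈ ps) ⇔ ((f x , g y) ∈ map (Product.map f g) ps)
  map-×-∈⇔ f-inj g-inj ps = mk⇔ (∈-map⁺ _) from
    where
    from : ∀ {x y} → (f x , g y) ∈ map (Product.map f g) ps → (x , y) ∈ ps
    from m with ∈-map⁻ _ m
    ... | _ , p∈ps , fxgy≡ with f-inj (cong Product.proj₁ fxgy≡) | g-inj (cong Product.proj₂ fxgy≡)
    ...   | refl | refl = p∈ps

  map-×-∃ˡ⇔ : Injective _≡_ _≡_ f → ∀ ps x →
    (∃ λ y → (x , y) ∈ ps) ⇔ (∃ λ z → (f x , z) ∈ map (Product.map f g) ps)
  map-×-∃ˡ⇔ f-inj ps x = mk⇔ (λ (y , m) → g y , ∈-map⁺ _ m) from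
    where
    from : (∃ λ z → (f x , z) ∈ map (Product.map f g) ps) → ∃ λ y → (x , y) ∈ ps
    from (_ , m) with ∈-map⁻ _ m
    ... | (_ , y) , p∈ps , fx≡ with f-inj (cong Product.proj₁ fx≡)
    ...   | refl = y , p∈ps

  map-×-∃ʳ⇔ : Injective _≡_ _≡_ g → ∀ ps y →
    (∃ λ x → (x , y) ∈ ps) ⇔ (∃ λ z → (z , g y) ∈ map (Product.map f g) ps)
  map-×-∃ʳ⇔ g-inj ps y = mk⇔ (λ (x , m) → f x , ∈-map⁺ _ m) from
    where
    from : (∃ λ z → (z , g y) ∈ map (Product.map f g) ps) → ∃ λ x → (x , y) ∈ ps
    from (_ , m) with ∈-map⁻ _ m
    ... | (x , _) , p∈ps , gy≡ with g-inj (cong Product.proj₂ gy≡)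
    ...   | refl = x , p∈ps

lemma5p4 : (n : ℕ) (w : Permutation′ n) (D : PipeDream) → InRP n w D →
    (i : ℕ) → 1 ≤ i → i < n →
    let r = φ n D in
    (∀ j j' → D i j ≡ true → D (suc i) j' ≡ true →
      ((j , j') ∈ rowPairs n D i) ⇔ ((i + j ∸ 1 , suc i + j' ∸ 1) ∈ blockPairs r i)) ×
    (∀ j → D i j ≡ true →
      (¬ (∃ λ j' → (j , j') ∈ rowPairs n D i)) ⇔
      (¬ (∃ λ b → (i + j ∸ 1 , b) ∈ blockPairs r i))) ×
    (∀ j' → D (suc i) j' ≡ true →
      (¬ (∃ λ j → (j , j') ∈ rowPairs n D i)) ⇔
      (¬ (∃ λ a → (a , suc i + j' ∸ 1) ∈ blockPairs r i)))
lemma5p4 n w D _ (suc k) (s≤s z≤n) _ rewrite blockPairs-φ n D k =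
  (λ _ _ _ _ → map-×-∈⇔ {f = k +_} {g = suc ∘ (k +_)} shift-inj suc-shift-inj pairs) ,
  (λ j _ → ¬-cong-⇔ (map-×-∃ˡ⇔ {g = suc ∘ (k +_)} shift-inj pairs j)) ,
  (λ j' _ → ¬-cong-⇔ (map-×-∃ʳ⇔ {f = k +_} suc-shift-inj pairs j'))
  where
  pairs : List (ℕ × ℕ)
  pairs = rowPairs n D (suc k)

  shift-inj : Injective _≡_ _≡_ (k +_)
  shift-inj = +-cancelˡ-≡ k _ _

  suc-shift-inj : Injective _≡_ _≡_ (suc ∘ (k +_))
  suc-shift-inj = shift-inj ∘ suc-injective
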